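{- Let $q$ be a prime power and $u\in\mathbb{F}_{q^3}\setminus\mathbb{F}_q$. Then the $\mathbb{F}_q$-subspace $U=\{(\alpha_0+\alpha_1u,\,\alpha_2+\alpha_3u,\,\alpha_4+\alpha_5u,\,\alpha_6+\alpha_7u):\alpha_i\in\mathbb{F}_q\}$ of $\mathbb{F}_{q^3}^4$ is a cutting $[8,4]_{q^3/q}$ system.
   Context: An $[n,k]_{q^m/q}$ system is an $\mathbb{F}_q$-subspace $U\subseteq\mathbb{F}_{q^m}^k$ with $\dim_{\mathbb{F}_q}(U)=n$ and $\langle U\rangle_{\mathbb{F}_{q^m}}=\mathbb{F}_{q^m}^k$. It is cutting if for every $\mathbb{F}_{q^m}$-hyperplane $H$ of $\mathbb{F}_{q^m}^k$ one has $\langle H\cap U\rangle_{\mathbb{F}_{q^m}}=H$. -}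

module Defs where

open import Level using (0ℓ)
open import Data.Nat using (ℕ; zero; suc; _^_; _≥_)
open import Data.Nat.Primality using (Prime)
open import Data.Fin using (Fin; zero; suc)
open import Data.Product using (Σ; ∃; ∃-syntax; _×_; _,_)
open import Function using (_∘_)
open import Function.Bundles using (_↔_)
open import Relation.Nullary using (¬_)
open import Relation.Binary.PropositionalEquality using (_≡_; _≢_)
open import Algebra.Core using (Op₁; Op₂)
open import Algebra.Structures using (IsCommutativeRing)

IsPrimePower : ℕ → Set
IsPrimePower q = ∃[ p ] ∃[ e ] (Prime p × e ≥ 1 × q ≡ p ^ e)

record Field : Set₁ where
  infixl 6 _+_
  infixl 7 _*_
  field
    Carrier : Set
    _+_ _*_ : Op₂ Carrier
    -_      : Op₁ Carrier
    0# 1#   : Carrier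
    isCommutativeRing : IsCommutativeRing _≡_ _+_ _*_ -_ 0# 1#
    0≢1     : 0# ≢ 1#
    inverse : ∀ x → x ≢ 0# → Σ Carrier (λ y → x * y ≡ 1#)

open Field public using (Carrier)

HasSize : Field → ℕ → Set
HasSize F N = Fin N ↔ Carrier F

-- An embedding of fields K ↪ L (an injective unital ring homomorphism);
-- its image is the subfield "F_q" of L.
record Embedding (K L : Field) : Set where
  private
    module K = Field K
    module L = Field L
  field
    ι      : K.Carrier → L.Carrier
    ι-0    : ι K.0# ≡ L.0#
    ι-1    : ι K.1# ≡ L.1#
    ι-+    : ∀ x y → ι (x K.+ y) ≡ ι x L.+ ι y
    ι-*    : ∀ x y → ι (x K.* y) ≡ ι x L.* ι y
    ι-inj  : ∀ x y → ι x ≡ ι y → x ≡ y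

open Embedding public using (ι)

module _ (K L : Field) (emb : Embedding K L) where
  private
    module K = Field K
    module L = Field L

  ∑ : (n : ℕ) → (Fin n → L.Carrier) → L.Carrier
  ∑ zero    f = L.0#
  ∑ (suc n) f = f zero L.+ ∑ n (f ∘ suc)

  Vect : ℕ → Set
  Vect k = Fin k → L.Carrier

  Pred : ℕ → Set₁
  Pred k = Vect k → Set

  IsKSubspace : (k : ℕ) → Pred k → Set
  IsKSubspace k U =
    U (λ _ → L.0#)
    × (∀ v w → U v → U w → U (λ i → v i L.+ w i))
    × (∀ (c : K.Carrier) v → U v → U (λ i → ι emb c L.* v i))

  HasKDim : (k n : ℕ) → Pred k → Set
  HasKDim k n U = Σ (Fin n → Vect k) λ b →
    (∀ j → U (b j))
    × (∀ (c : Fin n → K.Carrier) →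
         (∀ i → ∑ n (λ j → ι emb (c j) L.* b j i) ≡ L.0#) → ∀ j → c j ≡ K.0#)
    × (∀ v → U v → Σ (Fin n → K.Carrier) λ c →
         ∀ i → v i ≡ ∑ n (λ j → ι emb (c j) L.* b j i))

  InLSpan : (k : ℕ) → Pred k → Pred k
  InLSpan k S v = Σ ℕ λ m → Σ (Fin m → Vect k) λ w →
    (∀ j → S (w j))
    × Σ (Fin m → L.Carrier) λ c → ∀ i → v i ≡ ∑ m (λ j → c j L.* w j i)

  IsSystem : (n k : ℕ) → Pred k → Set
  IsSystem n k U = IsKSubspace k U × HasKDim k n U × (∀ v → InLSpan k U v)

  -- hyperplanes of L^k are exactly the kernels {v | ∑ a_i v_i = 0} of nonzero a
  NonzeroFunctional : (k : ℕ) → Vect k → Set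
  NonzeroFunctional k a = ∃[ i ] (a i ≢ L.0#)

  Hyperplane : (k : ℕ) → Vect k → Pred k
  Hyperplane k a v = ∑ k (λ i → a i L.* v i) ≡ L.0#

  -- cutting: for every hyperplane H, ⟨H ∩ U⟩ = H
  IsCutting : (k : ℕ) → Pred k → Set
  IsCutting k U = ∀ a → NonzeroFunctional k a → ∀ v →
    (Hyperplane k a v → InLSpan k (λ w → Hyperplane k a w × U w) v)
    × (InLSpan k (λ w → Hyperplane k a w × U w) v → Hyperplane k a v)

  IsCuttingSystem : (n k : ℕ) → Pred k → Set
  IsCuttingSystem n k U = IsSystem n k U × IsCutting k U

  U-example : L.Carrier → Pred 4
  U-example u v = Σ (Fin 8 → K.Carrier) λ α →
      v zero                   ≡ ι emb (α zero) L.+ ι emb (α (suc zero)) L.* u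
    × v (suc zero)             ≡ ι emb (α (suc (suc zero))) L.+ ι emb (α (suc (suc (suc zero)))) L.* u
    × v (suc (suc zero))       ≡ ι emb (α (suc (suc (suc (suc zero))))) L.+ ι emb (α (suc (suc (suc (suc (suc zero)))))) L.* u
    × v (suc (suc (suc zero))) ≡ ι emb (α (suc (suc (suc (suc (suc (suc zero))))))) L.+ ι emb (α (suc (suc (suc (suc (suc (suc (suc zero)))))))) L.* u

-- Write V = F_q + F_q u, a 2-dimensional F_q-subspace of F_{q^3} because u ∉ F_q, so that
-- U = V⁴; a basis of U is {e_m, u e_m}, and U contains the standard basis of F_{q^3}⁴.
-- For cutting, take a hyperplane Σ a_m x_m = 0 with a_i ≠ 0. For every t the F_q-linear map
-- V × V → F_{q^3}, (α, β) ↦ a_i α + a_t β, goes from q⁴ to q³ elements, so it has a nonzero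
-- kernel vector (α_t, β_t); then β_t ≠ 0, and w_t = α_t e_i + β_t e_t lies in H ∩ U.
-- Since α_t / β_t = - a_t / a_i, every v ∈ H equals Σ_t (v_t / β_t) w_t.
module Submission where

open import Defs
open import Level using (0ℓ)
open import Data.Nat using (ℕ; _^_)
import Data.Nat as ℕ
import Data.Nat.Properties as ℕ
open import Data.Nat.Primality using (prime⇒nonTrivial)
open import Data.Nat.Solver using (module +-*-Solver)
open import Data.Fin using (Fin; zero; suc)
open import Data.Fin.Properties using (pigeonhole; <⇒≢; *↔×; inj⇒≟)
open import Data.Product using (Σ; ∃; ∃₂; ∃-syntax; _×_; _,_; proj₁; proj₂)
open import Data.Product.Function.NonDependent.Propositional using (_×-↔_)
open import Data.Empty using (⊥-elim)
open import Function using (_∘_)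
open import Function.Bundles using (Injection; _↣_; _↔_)
open import Function.Properties.Inverse using (↔-sym; ↔-trans; ↔⇒↣)
open import Relation.Nullary using (¬_; yes; no)
open import Relation.Binary using (Decidable)
open import Relation.Binary.PropositionalEquality
  using (_≡_; _≢_; refl; sym; trans; cong; cong₂; subst; module ≡-Reasoning)
open import Algebra.Bundles using (CommutativeRing)

module FieldProperties (F : Field) where
  open Field F public hiding (Carrier)
  open ≡-Reasoning

  commutativeRing : CommutativeRing 0ℓ 0ℓ
  commutativeRing = record { isCommutativeRing = isCommutativeRing }

  open CommutativeRing commutativeRing public
    using ( +-comm; +-identityˡ; +-identityʳ; -‿inverseʳ
          ; *-comm; *-identityˡ; *-identityʳ; zeroˡ; zeroʳ; distribˡ )
  open import Algebra.Properties.Ring (CommutativeRing.ring commutativeRing) public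
    using (+-inverseˡ-unique; x∙y⁻¹≈ε⇒x≈y; x≈y⇒x∙y⁻¹≈ε; -‿+-comm; -‿distribˡ-*; -‿distribʳ-*; x[y-z]≈xy-xz)
  open import Algebra.Solver.Ring.NaturalCoefficients.Default
    (CommutativeRing.commutativeSemiring commutativeRing) public
    using (solve; _:=_; _:+_; _:*_; con)

  δ : ∀ {n} → Fin n → Fin n → Carrier F
  δ zero    zero    = 1#
  δ zero    (suc _) = 0#
  δ (suc _) zero    = 0#
  δ (suc i) (suc j) = δ i j

  δ-sym : ∀ {n} (i j : Fin n) → δ i j ≡ δ j i
  δ-sym zero    zero    = refl
  δ-sym zero    (suc _) = refl
  δ-sym (suc _) zero    = refl
  δ-sym (suc i) (suc j) = δ-sym i j

  x≢0∧xy≡0⇒y≡0 : ∀ {x y} → x ≢ 0# → x * y ≡ 0# → y ≡ 0#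
  x≢0∧xy≡0⇒y≡0 {x} {y} x≢0 xy≡0 = begin
    y                   ≡⟨ sym (*-identityʳ y) ⟩
    y * 1#              ≡⟨ cong (y *_) (sym xx⁻¹≡1) ⟩
    y * (x * x⁻¹)       ≡⟨ solve 3 (λ y x x⁻¹ → y :* (x :* x⁻¹) := x⁻¹ :* (x :* y)) refl y x x⁻¹ ⟩
    x⁻¹ * (x * y)       ≡⟨ cong (x⁻¹ *_) xy≡0 ⟩
    x⁻¹ * 0#            ≡⟨ zeroʳ x⁻¹ ⟩
    0#                  ∎
    where
    x⁻¹ = proj₁ (inverse x x≢0)
    xx⁻¹≡1 = proj₂ (inverse x x≢0)

  pα+rβ≡0⇒β⁻¹α≡-p⁻¹r : ∀ p r α β p⁻¹ β⁻¹ → p * α + r * β ≡ 0# →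
                        p * p⁻¹ ≡ 1# → β * β⁻¹ ≡ 1# → β⁻¹ * α ≡ - (p⁻¹ * r)
  pα+rβ≡0⇒β⁻¹α≡-p⁻¹r p r α β p⁻¹ β⁻¹ pα+rβ≡0 pp⁻¹≡1 ββ⁻¹≡1 = begin
    β⁻¹ * α                       ≡⟨ sym (*-identityʳ _) ⟩
    (β⁻¹ * α) * 1#                ≡⟨ cong ((β⁻¹ * α) *_) (sym pp⁻¹≡1) ⟩
    (β⁻¹ * α) * (p * p⁻¹)         ≡⟨ solve 4 (λ b a p q → (b :* a) :* (p :* q) := (q :* b) :* (p :* a)) refl β⁻¹ α p p⁻¹ ⟩
    (p⁻¹ * β⁻¹) * (p * α)         ≡⟨ cong ((p⁻¹ * β⁻¹) *_) (+-inverseˡ-unique (p * α) (r * β) pα+rβ≡0) ⟩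
    (p⁻¹ * β⁻¹) * - (r * β)       ≡⟨ sym (-‿distribʳ-* _ _) ⟩
    - ((p⁻¹ * β⁻¹) * (r * β))     ≡⟨ cong -_ (solve 4 (λ q b r x → (q :* b) :* (r :* x) := (q :* r) :* (x :* b)) refl p⁻¹ β⁻¹ r β) ⟩
    - ((p⁻¹ * r) * (β * β⁻¹))     ≡⟨ cong (λ z → - ((p⁻¹ * r) * z)) ββ⁻¹≡1 ⟩
    - ((p⁻¹ * r) * 1#)            ≡⟨ cong -_ (*-identityʳ _) ⟩
    - (p⁻¹ * r)                   ∎

  p[x-y]+r[z-w]≡[px+rz]-[py+rw] : ∀ p r x y z w →
    p * (x + - y) + r * (z + - w) ≡ (p * x + r * z) + - (p * y + r * w)
  p[x-y]+r[z-w]≡[px+rz]-[py+rw] p r x y z w = begin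
    p * (x + - y) + r * (z + - w)              ≡⟨ cong₂ _+_ (x[y-z]≈xy-xz p x y) (x[y-z]≈xy-xz r z w) ⟩
    (p * x + - (p * y)) + (r * z + - (r * w))  ≡⟨ solve 4 (λ a b c d → (a :+ b) :+ (c :+ d) := (a :+ c) :+ (b :+ d)) refl _ _ _ _ ⟩
    (p * x + r * z) + (- (p * y) + - (r * w))  ≡⟨ cong ((p * x + r * z) +_) (-‿+-comm (p * y) (r * w)) ⟩
    (p * x + r * z) + - (p * y + r * w)        ∎

module EmbeddingProperties {K L : Field} (emb : Embedding K L) where
  private
    module K = FieldProperties K
    module L = FieldProperties L
  open Embedding emb using (ι-0; ι-1; ι-+; ι-inj)
  open ≡-Reasoning

  ι-neg : ∀ x → ι emb (K.- x) ≡ L.- ι emb x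
  ι-neg x = L.+-inverseˡ-unique _ _ (begin
    ι emb (K.- x) L.+ ι emb x   ≡⟨ sym (ι-+ (K.- x) x) ⟩
    ι emb (K.- x K.+ x)         ≡⟨ cong (ι emb) (K.+-comm (K.- x) x) ⟩
    ι emb (x K.+ K.- x)         ≡⟨ cong (ι emb) (K.-‿inverseʳ x) ⟩
    ι emb K.0#                  ≡⟨ ι-0 ⟩
    L.0#                        ∎)

  ι-δ : ∀ {n} (i j : Fin n) → ι emb (K.δ i j) ≡ L.δ i j
  ι-δ zero    zero    = ι-1
  ι-δ zero    (suc _) = ι-0
  ι-δ (suc _) zero    = ι-0
  ι-δ (suc i) (suc j) = ι-δ i j

  ι≡0⇒≡0 : ∀ {x} → ι emb x ≡ L.0# → x ≡ K.0#
  ι≡0⇒≡0 {x} ιx≡0 = ι-inj x K.0# (trans ιx≡0 (sym ι-0))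

module Sums {K L : Field} (emb : Embedding K L) where
  open FieldProperties L
  open ≡-Reasoning

  ∑ₗ : (n : ℕ) → (Fin n → Carrier L) → Carrier L
  ∑ₗ = ∑ K L emb

  ∑-cong : ∀ n {f g : Fin n → Carrier L} → (∀ j → f j ≡ g j) → ∑ₗ n f ≡ ∑ₗ n g
  ∑-cong ℕ.zero    f≗g = refl
  ∑-cong (ℕ.suc n) f≗g = cong₂ _+_ (f≗g zero) (∑-cong n (f≗g ∘ suc))

  ∑-0 : ∀ n → ∑ₗ n (λ _ → 0#) ≡ 0#
  ∑-0 ℕ.zero    = refl
  ∑-0 (ℕ.suc n) = trans (cong (0# +_) (∑-0 n)) (+-identityʳ 0#)

  ∑-+ : ∀ n (f g : Fin n → Carrier L) → ∑ₗ n (λ j → f j + g j) ≡ ∑ₗ n f + ∑ₗ n g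
  ∑-+ ℕ.zero    f g = sym (+-identityʳ 0#)
  ∑-+ (ℕ.suc n) f g = begin
    (f zero + g zero) + ∑ₗ n (λ j → f (suc j) + g (suc j))
      ≡⟨ cong ((f zero + g zero) +_) (∑-+ n (f ∘ suc) (g ∘ suc)) ⟩
    (f zero + g zero) + (∑ₗ n (f ∘ suc) + ∑ₗ n (g ∘ suc))
      ≡⟨ solve 4 (λ a b c d → (a :+ b) :+ (c :+ d) := (a :+ c) :+ (b :+ d)) refl (f zero) (g zero) _ _ ⟩
    (f zero + ∑ₗ n (f ∘ suc)) + (g zero + ∑ₗ n (g ∘ suc))
      ∎

  ∑-*ˡ : ∀ n c (f : Fin n → Carrier L) → ∑ₗ n (λ j → c * f j) ≡ c * ∑ₗ n f
  ∑-*ˡ ℕ.zero    c f = sym (zeroʳ c)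
  ∑-*ˡ (ℕ.suc n) c f = trans (cong (c * f zero +_) (∑-*ˡ n c (f ∘ suc))) (sym (distribˡ c (f zero) _))

  ∑-*ʳ : ∀ n c (f : Fin n → Carrier L) → ∑ₗ n (λ j → f j * c) ≡ ∑ₗ n f * c
  ∑-*ʳ n c f = begin
    ∑ₗ n (λ j → f j * c)   ≡⟨ ∑-cong n (λ j → *-comm (f j) c) ⟩
    ∑ₗ n (λ j → c * f j)   ≡⟨ ∑-*ˡ n c f ⟩
    c * ∑ₗ n f             ≡⟨ *-comm c _ ⟩
    ∑ₗ n f * c             ∎

  ∑-swap : ∀ n m (f : Fin n → Fin m → Carrier L) →
           ∑ₗ n (λ i → ∑ₗ m (f i)) ≡ ∑ₗ m (λ j → ∑ₗ n (λ i → f i j))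
  ∑-swap ℕ.zero    m f = sym (∑-0 m)
  ∑-swap (ℕ.suc n) m f = begin
    ∑ₗ m (f zero) + ∑ₗ n (λ i → ∑ₗ m (f (suc i)))
      ≡⟨ cong (∑ₗ m (f zero) +_) (∑-swap n m (f ∘ suc)) ⟩
    ∑ₗ m (f zero) + ∑ₗ m (λ j → ∑ₗ n (λ i → f (suc i) j))
      ≡⟨ sym (∑-+ m (f zero) _) ⟩
    ∑ₗ m (λ j → f zero j + ∑ₗ n (λ i → f (suc i) j))
      ∎

  ∑-δ : ∀ n (f : Fin n → Carrier L) i → ∑ₗ n (λ j → f j * δ j i) ≡ f i
  ∑-δ (ℕ.suc n) f zero = begin
    f zero * 1# + ∑ₗ n (λ j → f (suc j) * 0#)
      ≡⟨ cong₂ _+_ (*-identityʳ (f zero)) (trans (∑-cong n (λ j → zeroʳ (f (suc j)))) (∑-0 n)) ⟩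
    f zero + 0#
      ≡⟨ +-identityʳ _ ⟩
    f zero
      ∎
  ∑-δ (ℕ.suc n) f (suc i) = begin
    f zero * 0# + ∑ₗ n (λ j → f (suc j) * δ j i)
      ≡⟨ cong₂ _+_ (zeroʳ (f zero)) (∑-δ n (f ∘ suc) i) ⟩
    0# + f (suc i)
      ≡⟨ +-identityˡ _ ⟩
    f (suc i)
      ∎

module Hyperplanes {K L : Field} (emb : Embedding K L) where
  open FieldProperties L
  open Sums emb
  open ≡-Reasoning

  span⊆hyperplane : ∀ {k} (a : Vect K L emb k) (S : Pred K L emb k) →
                    (∀ w → S w → Hyperplane K L emb k a w) →
                    ∀ v → InLSpan K L emb k S v → Hyperplane K L emb k a v
  span⊆hyperplane {k} a S S⊆H v (m , w , w∈S , c , v≡∑cw) = begin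
    ∑ₗ k (λ i → a i * v i)
      ≡⟨ ∑-cong k (λ i → cong (a i *_) (v≡∑cw i)) ⟩
    ∑ₗ k (λ i → a i * ∑ₗ m (λ t → c t * w t i))
      ≡⟨ ∑-cong k (λ i → trans (sym (∑-*ˡ m (a i) _)) (∑-cong m (λ t →
           solve 3 (λ x y z → x :* (y :* z) := y :* (x :* z)) refl (a i) (c t) (w t i)))) ⟩
    ∑ₗ k (λ i → ∑ₗ m (λ t → c t * (a i * w t i)))
      ≡⟨ ∑-swap k m (λ i t → c t * (a i * w t i)) ⟩
    ∑ₗ m (λ t → ∑ₗ k (λ i → c t * (a i * w t i)))
      ≡⟨ ∑-cong m (λ t → trans (∑-*ˡ k (c t) _) (trans (cong (c t *_) (S⊆H (w t) (w∈S t))) (zeroʳ (c t)))) ⟩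
    ∑ₗ m (λ _ → 0#)
      ≡⟨ ∑-0 m ⟩
    0#  ∎

  standard-basis-spans : ∀ {k} (S : Pred K L emb k) → (∀ m → S (δ m)) → ∀ v → InLSpan K L emb k S v
  standard-basis-spans {k} S δ∈S v = k , δ , δ∈S , v , λ i → sym (∑-δ k v i)

  hyperplane⊆span : ∀ {k} (S : Pred K L emb k) (a : Vect K L emb k) (i : Fin k) → a i ≢ 0# →
    (α β : Fin k → Carrier L) → (∀ t → β t ≢ 0#) → (∀ t → a i * α t + a t * β t ≡ 0#) →
    (∀ t → S (λ m → α t * δ i m + β t * δ t m)) →
    ∀ v → Hyperplane K L emb k a v → InLSpan K L emb k (λ w → Hyperplane K L emb k a w × S w) v
  hyperplane⊆span {k} S a i aᵢ≢0 α β β≢0 aα+aβ≡0 w∈S v v∈H =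
    k , w , (λ t → w∈H t , w∈S t) , (λ t → v t * β⁻¹ t) , λ m → sym (decomposition m)
    where
    w : Fin k → Vect K L emb k
    w t m = α t * δ i m + β t * δ t m

    a⁻¹ = proj₁ (inverse (a i) aᵢ≢0)
    β⁻¹ = λ t → proj₁ (inverse (β t) (β≢0 t))

    w∈H : ∀ t → Hyperplane K L emb k a (w t)
    w∈H t = begin
      ∑ₗ k (λ m → a m * (α t * δ i m + β t * δ t m))
        ≡⟨ ∑-cong k (λ m → trans (cong₂ (λ d e → a m * (α t * d + β t * e)) (δ-sym i m) (δ-sym t m))
             (solve 5 (λ A x y d e → A :* (x :* d :+ y :* e) := x :* (A :* d) :+ y :* (A :* e))
                refl (a m) (α t) (β t) (δ m i) (δ m t))) ⟩
      ∑ₗ k (λ m → α t * (a m * δ m i) + β t * (a m * δ m t))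
        ≡⟨ ∑-+ k _ _ ⟩
      ∑ₗ k (λ m → α t * (a m * δ m i)) + ∑ₗ k (λ m → β t * (a m * δ m t))
        ≡⟨ cong₂ _+_ (trans (∑-*ˡ k (α t) _) (cong (α t *_) (∑-δ k a i)))
                     (trans (∑-*ˡ k (β t) _) (cong (β t *_) (∑-δ k a t))) ⟩
      α t * a i + β t * a t
        ≡⟨ cong₂ _+_ (*-comm (α t) (a i)) (*-comm (β t) (a t)) ⟩
      a i * α t + a t * β t
        ≡⟨ aα+aβ≡0 t ⟩
      0#  ∎

    term : ∀ t m → (v t * β⁻¹ t) * w t m ≡ v t * δ t m + (δ i m * - a⁻¹) * (a t * v t)
    term t m = begin
      (v t * β⁻¹ t) * (α t * δ i m + β t * δ t m)
        ≡⟨ solve 6 (λ V b x y d e → (V :* b) :* (x :* d :+ y :* e) := V :* ((b :* x) :* d :+ (y :* b) :* e))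
             refl (v t) (β⁻¹ t) (α t) (β t) (δ i m) (δ t m) ⟩
      v t * ((β⁻¹ t * α t) * δ i m + (β t * β⁻¹ t) * δ t m)
        ≡⟨ cong₂ (λ x y → v t * (x * δ i m + y * δ t m)) ratio (proj₂ (inverse (β t) (β≢0 t))) ⟩
      v t * ((- a⁻¹ * a t) * δ i m + 1# * δ t m)
        ≡⟨ solve 5 (λ V c A d e → V :* ((c :* A) :* d :+ con 1 :* e) := V :* e :+ (d :* c) :* (A :* V))
             refl (v t) (- a⁻¹) (a t) (δ i m) (δ t m) ⟩
      v t * δ t m + (δ i m * - a⁻¹) * (a t * v t)
        ∎
      where
      ratio : β⁻¹ t * α t ≡ - a⁻¹ * a t
      ratio = trans (pα+rβ≡0⇒β⁻¹α≡-p⁻¹r (a i) (a t) (α t) (β t) a⁻¹ (β⁻¹ t) (aα+aβ≡0 t)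
                       (proj₂ (inverse (a i) aᵢ≢0)) (proj₂ (inverse (β t) (β≢0 t))))
                    (-‿distribˡ-* a⁻¹ (a t))

    decomposition : ∀ m → ∑ₗ k (λ t → (v t * β⁻¹ t) * w t m) ≡ v m
    decomposition m = begin
      ∑ₗ k (λ t → (v t * β⁻¹ t) * w t m)
        ≡⟨ ∑-cong k (λ t → term t m) ⟩
      ∑ₗ k (λ t → v t * δ t m + (δ i m * - a⁻¹) * (a t * v t))
        ≡⟨ ∑-+ k _ _ ⟩
      ∑ₗ k (λ t → v t * δ t m) + ∑ₗ k (λ t → (δ i m * - a⁻¹) * (a t * v t))
        ≡⟨ cong₂ _+_ (∑-δ k v m) (∑-*ˡ k (δ i m * - a⁻¹) _) ⟩
      v m + (δ i m * - a⁻¹) * ∑ₗ k (λ t → a t * v t)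
        ≡⟨ cong (λ z → v m + (δ i m * - a⁻¹) * z) v∈H ⟩
      v m + (δ i m * - a⁻¹) * 0#
        ≡⟨ trans (cong (v m +_) (zeroʳ _)) (+-identityʳ _) ⟩
      v m  ∎

even odd : ∀ {n} → Fin n → Fin (n ℕ.* 2)
even zero    = zero
even (suc i) = suc (suc (even i))
odd  zero    = suc zero
odd  (suc i) = suc (suc (odd i))

parity-elim : ∀ {n} {P : Fin (n ℕ.* 2) → Set} →
              ((i : Fin n) → P (even i)) → ((i : Fin n) → P (odd i)) → ∀ t → P t
parity-elim {ℕ.suc n} pe po zero          = pe zero
parity-elim {ℕ.suc n} pe po (suc zero)    = po zero
parity-elim {ℕ.suc n} {P} pe po (suc (suc t)) =
  parity-elim {n} {P ∘ suc ∘ suc} (pe ∘ suc) (po ∘ suc) t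

parity-elim-even : ∀ {n} {P : Fin (n ℕ.* 2) → Set} (pe : (i : Fin n) → P (even i)) (po : (i : Fin n) → P (odd i)) →
                   ∀ i → parity-elim {P = P} pe po (even i) ≡ pe i
parity-elim-even pe po zero    = refl
parity-elim-even {ℕ.suc n} {P} pe po (suc i) = parity-elim-even {n} {P ∘ suc ∘ suc} (pe ∘ suc) (po ∘ suc) i

parity-elim-odd : ∀ {n} {P : Fin (n ℕ.* 2) → Set} (pe : (i : Fin n) → P (even i)) (po : (i : Fin n) → P (odd i)) →
                  ∀ i → parity-elim {P = P} pe po (odd i) ≡ po i
parity-elim-odd pe po zero    = refl
parity-elim-odd {ℕ.suc n} {P} pe po (suc i) = parity-elim-odd {n} {P ∘ suc ∘ suc} (pe ∘ suc) (po ∘ suc) i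

pigeonhole-↣ : ∀ {m n} {A B : Set} → m ℕ.< n → Fin n ↣ A → B ↣ Fin m →
               (f : A → B) → ∃₂ λ x y → x ≢ y × f x ≡ f y
pigeonhole-↣ m<n from-Fin to-Fin f
  with i , j , i<j , fi≡fj ← pigeonhole m<n (Injection.to to-Fin ∘ f ∘ Injection.to from-Fin)
  = Injection.to from-Fin i , Injection.to from-Fin j
  , <⇒≢ i<j ∘ Injection.injective from-Fin
  , Injection.injective to-Fin fi≡fj

prime-power>1 : ∀ {q} → IsPrimePower q → 1 ℕ.< q
prime-power>1 (p , e , p-prime , e≥1 , refl) =
  ℕ.^-monoʳ-< p (ℕ.nonTrivial⇒n>1 p {{prime⇒nonTrivial p-prime}}) e≥1

q³<[q*q]*[q*q] : ∀ {q} → 1 ℕ.< q → q ^ 3 ℕ.< (q ℕ.* q) ℕ.* (q ℕ.* q)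
q³<[q*q]*[q*q] {q} 1<q = subst (q ^ 3 ℕ.<_) q⁴≡[q*q]*[q*q] (ℕ.^-monoʳ-< q 1<q (ℕ.n<1+n 3))
  where
  open +-*-Solver
  q⁴≡[q*q]*[q*q] : q ^ 4 ≡ (q ℕ.* q) ℕ.* (q ℕ.* q)
  q⁴≡[q*q]*[q*q] = solve 1 (λ q → q :^ 4 := (q :* q) :* (q :* q)) refl q

Fin[q*q]↔² : ∀ {q} {A : Set} → Fin q ↔ A → Fin (q ℕ.* q) ↔ (A × A)
Fin[q*q]↔² Fin-q↔A = ↔-trans *↔× (Fin-q↔A ×-↔ Fin-q↔A)

Fin[q*q]*[q*q]↣⁴ : ∀ {q} {A : Set} → Fin q ↔ A → Fin ((q ℕ.* q) ℕ.* (q ℕ.* q)) ↣ ((A × A) × (A × A))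
Fin[q*q]*[q*q]↣⁴ Fin-q↔A = ↔⇒↣ (↔-trans *↔× (Fin[q*q]↔² Fin-q↔A ×-↔ Fin[q*q]↔² Fin-q↔A))

module Example {K L : Field} (emb : Embedding K L) (_≟_ : Decidable (_≡_ {A = Carrier K}))
               (u : Carrier L) (u∉K : ¬ (∃[ a ] ι emb a ≡ u)) where
  private
    module K = FieldProperties K
  open FieldProperties L
  open EmbeddingProperties emb
  open Sums emb
  open Hyperplanes emb
  open Embedding emb using (ι-0; ι-1; ι-+; ι-*)
  open ≡-Reasoning

  U : Pred K L emb 4
  U = U-example K L emb u

  ν : Carrier K × Carrier K → Carrier L
  ν (x , y) = ι emb x + ι emb y * u

  InV : Carrier L → Set
  InV z = ∃ λ a → z ≡ ν a

  _⊕_ _⊖_ : Carrier K × Carrier K → Carrier K × Carrier K → Carrier K × Carrier K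
  (x , y) ⊕ (x′ , y′) = x K.+ x′ , y K.+ y′
  (x , y) ⊖ (x′ , y′) = x K.+ K.- x′ , y K.+ K.- y′

  ν-0 : ν (K.0# , K.0#) ≡ 0#
  ν-0 = begin
    ι emb K.0# + ι emb K.0# * u   ≡⟨ cong (λ z → z + z * u) ι-0 ⟩
    0# + 0# * u                   ≡⟨ cong (0# +_) (zeroˡ u) ⟩
    0# + 0#                       ≡⟨ +-identityʳ 0# ⟩
    0#                            ∎

  ν-ι : ∀ c → ν (c , K.0#) ≡ ι emb c
  ν-ι c = begin
    ι emb c + ι emb K.0# * u   ≡⟨ cong (λ z → ι emb c + z * u) ι-0 ⟩
    ι emb c + 0# * u           ≡⟨ cong (ι emb c +_) (zeroˡ u) ⟩
    ι emb c + 0#               ≡⟨ +-identityʳ _ ⟩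
    ι emb c                    ∎

  ν-⊕ : ∀ a b → ν a + ν b ≡ ν (a ⊕ b)
  ν-⊕ (x , y) (x′ , y′) = begin
    (ι emb x + ι emb y * u) + (ι emb x′ + ι emb y′ * u)
      ≡⟨ solve 5 (λ a b c d e → (a :+ b :* e) :+ (c :+ d :* e) := (a :+ c) :+ (b :+ d) :* e)
           refl (ι emb x) (ι emb y) (ι emb x′) (ι emb y′) u ⟩
    (ι emb x + ι emb x′) + (ι emb y + ι emb y′) * u
      ≡⟨ sym (cong₂ (λ s t → s + t * u) (ι-+ x x′) (ι-+ y y′)) ⟩
    ι emb (x K.+ x′) + ι emb (y K.+ y′) * u
      ∎

  ν-scale : ∀ c a → ι emb c * ν a ≡ ν (c K.* proj₁ a , c K.* proj₂ a)
  ν-scale c (x , y) = begin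
    ι emb c * (ι emb x + ι emb y * u)
      ≡⟨ solve 4 (λ c a b e → c :* (a :+ b :* e) := c :* a :+ (c :* b) :* e) refl (ι emb c) (ι emb x) (ι emb y) u ⟩
    ι emb c * ι emb x + (ι emb c * ι emb y) * u
      ≡⟨ sym (cong₂ (λ s t → s + t * u) (ι-* c x) (ι-* c y)) ⟩
    ι emb (c K.* x) + ι emb (c K.* y) * u
      ∎

  ν-⊖ : ∀ a b → ν (a ⊖ b) ≡ ν a + - ν b
  ν-⊖ a@(x , y) b@(x′ , y′) = begin
    ν (a ⊖ b)                                       ≡⟨ sym (ν-⊕ a (K.- x′ , K.- y′)) ⟩
    ν a + (ι emb (K.- x′) + ι emb (K.- y′) * u)     ≡⟨ cong₂ (λ s t → ν a + (s + t * u)) (ι-neg x′) (ι-neg y′) ⟩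
    ν a + (- ι emb x′ + - ι emb y′ * u)             ≡⟨ cong (λ t → ν a + (- ι emb x′ + t)) (sym (-‿distribˡ-* _ u)) ⟩
    ν a + (- ι emb x′ + - (ι emb y′ * u))           ≡⟨ cong (ν a +_) (-‿+-comm _ _) ⟩
    ν a + - ν b                                     ∎

  -- Here u ∉ F_q is used: a nonzero coefficient of u would put u = - x / y in F_q.
  ν≡0⇒≡0 : ∀ x y → ν (x , y) ≡ 0# → x ≡ K.0# × y ≡ K.0#
  ν≡0⇒≡0 x y ν≡0 with y ≟ K.0#
  ... | yes refl = ι≡0⇒≡0 (trans (sym (ν-ι x)) ν≡0) , refl
  ... | no y≢0 = ⊥-elim (u∉K (K.- (y⁻¹ K.* x) , sym u≡ι[-y⁻¹x]))
    where
    y⁻¹ = proj₁ (K.inverse y y≢0)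

    yu≡-x : ι emb y * u ≡ - ι emb x
    yu≡-x = +-inverseˡ-unique _ _ (trans (+-comm _ _) ν≡0)

    u≡ι[-y⁻¹x] : u ≡ ι emb (K.- (y⁻¹ K.* x))
    u≡ι[-y⁻¹x] = begin
      u                               ≡⟨ sym (*-identityˡ u) ⟩
      1# * u                          ≡⟨ cong (_* u) (sym ι-1) ⟩
      ι emb K.1# * u                  ≡⟨ cong (λ z → ι emb z * u) (sym (proj₂ (K.inverse y y≢0))) ⟩
      ι emb (y K.* y⁻¹) * u           ≡⟨ cong (_* u) (ι-* y y⁻¹) ⟩
      (ι emb y * ι emb y⁻¹) * u       ≡⟨ solve 3 (λ a b c → (a :* b) :* c := b :* (a :* c)) refl (ι emb y) (ι emb y⁻¹) u ⟩
      ι emb y⁻¹ * (ι emb y * u)       ≡⟨ cong (ι emb y⁻¹ *_) yu≡-x ⟩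
      ι emb y⁻¹ * - ι emb x           ≡⟨ sym (-‿distribʳ-* _ _) ⟩
      - (ι emb y⁻¹ * ι emb x)         ≡⟨ cong -_ (sym (ι-* y⁻¹ x)) ⟩
      - ι emb (y⁻¹ K.* x)             ≡⟨ sym (ι-neg _) ⟩
      ι emb (K.- (y⁻¹ K.* x))         ∎

  ν[a⊖b]≡0⇒a≡b : ∀ a b → ν (a ⊖ b) ≡ 0# → a ≡ b
  ν[a⊖b]≡0⇒a≡b (x , y) (x′ , y′) ν≡0 =
    let x-x′≡0 , y-y′≡0 = ν≡0⇒≡0 _ _ ν≡0
    in cong₂ _,_ (K.x∙y⁻¹≈ε⇒x≈y x x′ x-x′≡0) (K.x∙y⁻¹≈ε⇒x≈y y y′ y-y′≡0)

  InV-0 : InV 0#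
  InV-0 = (K.0# , K.0#) , sym ν-0

  InV-ι : ∀ c → InV (ι emb c)
  InV-ι c = (c , K.0#) , sym (ν-ι c)

  InV-+ : ∀ {z z′} → InV z → InV z′ → InV (z + z′)
  InV-+ (a , refl) (b , refl) = a ⊕ b , ν-⊕ a b

  InV-ι* : ∀ c {z} → InV z → InV (ι emb c * z)
  InV-ι* c (a , refl) = _ , ν-scale c a

  InV-*δ : ∀ {n z} (i m : Fin n) → InV z → InV (z * δ i m)
  InV-*δ {z = z} i m z∈V = subst InV (trans (*-comm _ z) (cong (z *_) (ι-δ i m))) (InV-ι* (K.δ i m) z∈V)

  U⇒coefficients : ∀ v → U v → Σ (Fin 8 → Carrier K) λ α → ∀ i → v i ≡ ν (α (even i) , α (odd i))
  U⇒coefficients v (α , v₀ , v₁ , v₂ , v₃) = α , λ where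
    zero                   → v₀
    (suc zero)             → v₁
    (suc (suc zero))       → v₂
    (suc (suc (suc zero))) → v₃

  coefficients⇒U : ∀ v (α : Fin 8 → Carrier K) → (∀ i → v i ≡ ν (α (even i) , α (odd i))) → U v
  coefficients⇒U v α v≡να =
    α , v≡να zero , v≡να (suc zero) , v≡να (suc (suc zero)) , v≡να (suc (suc (suc zero)))

  U⇒pointwise : ∀ v → U v → ∀ i → InV (v i)
  U⇒pointwise v v∈U i = let α , v≡να = U⇒coefficients v v∈U in _ , v≡να i

  pointwise⇒U : ∀ v → (∀ i → InV (v i)) → U v
  pointwise⇒U v v∈V = coefficients⇒U v α v≡να
    where
    α : Fin 8 → Carrier K
    α = parity-elim (proj₁ ∘ proj₁ ∘ v∈V) (proj₂ ∘ proj₁ ∘ v∈V)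

    v≡να : ∀ i → v i ≡ ν (α (even i) , α (odd i))
    v≡να i = trans (proj₂ (v∈V i))
      (sym (cong₂ (λ x y → ν (x , y)) (parity-elim-even _ _ i) (parity-elim-odd _ _ i)))

  U-subspace : IsKSubspace K L emb 4 U
  U-subspace =
      pointwise⇒U (λ _ → 0#) (λ _ → InV-0)
    , (λ v w v∈U w∈U → pointwise⇒U (λ i → v i + w i) λ i →
         InV-+ (U⇒pointwise v v∈U i) (U⇒pointwise w w∈U i))
    , (λ c v v∈U → pointwise⇒U (λ i → ι emb c * v i) λ i → InV-ι* c (U⇒pointwise v v∈U i))

  basis : Fin 8 → Vect K L emb 4
  basis t i = δ t (even i) + δ t (odd i) * u

  basis∈U : ∀ t → U (basis t)
  basis∈U t = coefficients⇒U (basis t) (K.δ t) λ i →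
    sym (cong₂ (λ x y → x + y * u) (ι-δ t (even i)) (ι-δ t (odd i)))

  ∑-basis : ∀ (c : Fin 8 → Carrier K) i → ∑ₗ 8 (λ t → ι emb (c t) * basis t i) ≡ ν (c (even i) , c (odd i))
  ∑-basis c i = begin
    ∑ₗ 8 (λ t → ι emb (c t) * (δ t (even i) + δ t (odd i) * u))
      ≡⟨ ∑-cong 8 (λ t → solve 4 (λ c d e u → c :* (d :+ e :* u) := c :* d :+ (c :* e) :* u)
                            refl (ι emb (c t)) (δ t (even i)) (δ t (odd i)) u) ⟩
    ∑ₗ 8 (λ t → ι emb (c t) * δ t (even i) + (ι emb (c t) * δ t (odd i)) * u)
      ≡⟨ trans (∑-+ 8 (λ t → ι emb (c t) * δ t (even i)) (λ t → (ι emb (c t) * δ t (odd i)) * u))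
               (cong (∑ₗ 8 (λ t → ι emb (c t) * δ t (even i)) +_) (∑-*ʳ 8 u (λ t → ι emb (c t) * δ t (odd i)))) ⟩
    ∑ₗ 8 (λ t → ι emb (c t) * δ t (even i)) + ∑ₗ 8 (λ t → ι emb (c t) * δ t (odd i)) * u
      ≡⟨ cong₂ (λ x y → x + y * u) (∑-δ 8 (ι emb ∘ c) (even i)) (∑-δ 8 (ι emb ∘ c) (odd i)) ⟩
    ν (c (even i) , c (odd i))
      ∎

  U-dimension : HasKDim K L emb 4 8 U
  U-dimension = basis , basis∈U , independent , spanning
    where
    independent : ∀ c → (∀ i → ∑ₗ 8 (λ t → ι emb (c t) * basis t i) ≡ 0#) → ∀ t → c t ≡ K.0#
    independent c ∑≡0 = parity-elim (proj₁ ∘ coefficients≡0) (proj₂ ∘ coefficients≡0)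
      where
      coefficients≡0 : ∀ i → c (even i) ≡ K.0# × c (odd i) ≡ K.0#
      coefficients≡0 i = ν≡0⇒≡0 _ _ (trans (sym (∑-basis c i)) (∑≡0 i))

    spanning : ∀ v → U v → Σ (Fin 8 → Carrier K) λ c → ∀ i → v i ≡ ∑ₗ 8 (λ t → ι emb (c t) * basis t i)
    spanning v v∈U = let α , v≡να = U⇒coefficients v v∈U in α , λ i → trans (v≡να i) (sym (∑-basis α i))

  U-spans : ∀ v → InLSpan K L emb 4 U v
  U-spans = standard-basis-spans U λ m → pointwise⇒U (δ m) λ i → subst InV (ι-δ m i) (InV-ι (K.δ m i))

  KernelVector : Carrier L → Carrier L → Set
  KernelVector p r = ∃₂ λ α β → InV α × InV β × β ≢ 0# × p * α + r * β ≡ 0#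

  collision⇒kernel-vector : ∀ p r → p ≢ 0# → ∀ a a′ b b′ → (a , a′) ≢ (b , b′) →
                            p * ν a + r * ν a′ ≡ p * ν b + r * ν b′ → KernelVector p r
  collision⇒kernel-vector p r p≢0 a a′ b b′ distinct f≡ =
    ν (a ⊖ b) , ν (a′ ⊖ b′) , (_ , refl) , (_ , refl) , β≢0 , pα+rβ≡0
    where
    pα+rβ≡0 : p * ν (a ⊖ b) + r * ν (a′ ⊖ b′) ≡ 0#
    pα+rβ≡0 = begin
      p * ν (a ⊖ b) + r * ν (a′ ⊖ b′)                ≡⟨ cong₂ (λ s t → p * s + r * t) (ν-⊖ a b) (ν-⊖ a′ b′) ⟩
      p * (ν a + - ν b) + r * (ν a′ + - ν b′)        ≡⟨ p[x-y]+r[z-w]≡[px+rz]-[py+rw] p r _ _ _ _ ⟩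
      (p * ν a + r * ν a′) + - (p * ν b + r * ν b′)  ≡⟨ x≈y⇒x∙y⁻¹≈ε f≡ ⟩
      0#                                             ∎

    β≢0 : ν (a′ ⊖ b′) ≢ 0#
    β≢0 β≡0 = distinct (cong₂ _,_ (ν[a⊖b]≡0⇒a≡b a b α≡0) (ν[a⊖b]≡0⇒a≡b a′ b′ β≡0))
      where
      α≡0 : ν (a ⊖ b) ≡ 0#
      α≡0 = x≢0∧xy≡0⇒y≡0 p≢0 (begin
        p * ν (a ⊖ b)                    ≡⟨ sym (+-identityʳ _) ⟩
        p * ν (a ⊖ b) + 0#               ≡⟨ cong (p * ν (a ⊖ b) +_) (sym (trans (cong (r *_) β≡0) (zeroʳ r))) ⟩
        p * ν (a ⊖ b) + r * ν (a′ ⊖ b′)  ≡⟨ pα+rβ≡0 ⟩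
        0#                               ∎)

  kernel-vector : ∀ {q} → 1 ℕ.< q → HasSize K q → HasSize L (q ^ 3) →
                  ∀ p r → p ≢ 0# → KernelVector p r
  kernel-vector 1<q |K|≡q |L|≡q³ p r p≢0 =
    let (a , a′) , (b , b′) , distinct , f≡ =
          pigeonhole-↣ (q³<[q*q]*[q*q] 1<q) (Fin[q*q]*[q*q]↣⁴ |K|≡q) (↔⇒↣ (↔-sym |L|≡q³)) f
    in collision⇒kernel-vector p r p≢0 a a′ b b′ distinct f≡
    where
    f : (Carrier K × Carrier K) × (Carrier K × Carrier K) → Carrier L
    f (a , a′) = p * ν a + r * ν a′

  U-cutting : (∀ p r → p ≢ 0# → KernelVector p r) → IsCutting K L emb 4 U
  U-cutting kernel a (i , aᵢ≢0) v =
      hyperplane⊆span U a i aᵢ≢0 α β β≢0 aα+aβ≡0 w∈U v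
    , span⊆hyperplane a (λ w → Hyperplane K L emb 4 a w × U w) (λ _ → proj₁) v
    where
    α β : Fin 4 → Carrier L
    α t = proj₁ (kernel (a i) (a t) aᵢ≢0)
    β t = proj₁ (proj₂ (kernel (a i) (a t) aᵢ≢0))

    β≢0 : ∀ t → β t ≢ 0#
    β≢0 t = let _ , _ , _ , _ , β≢0 , _ = kernel (a i) (a t) aᵢ≢0 in β≢0

    aα+aβ≡0 : ∀ t → a i * α t + a t * β t ≡ 0#
    aα+aβ≡0 t = let _ , _ , _ , _ , _ , aα+aβ≡0 = kernel (a i) (a t) aᵢ≢0 in aα+aβ≡0

    w∈U : ∀ t → U (λ m → α t * δ i m + β t * δ t m)
    w∈U t = let _ , _ , α∈V , β∈V , _ = kernel (a i) (a t) aᵢ≢0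
            in pointwise⇒U (λ m → α t * δ i m + β t * δ t m) λ m →
                 InV-+ (InV-*δ i m α∈V) (InV-*δ t m β∈V)

proposition3p13 : (q : ℕ) → IsPrimePower q →
    (K L : Field) → HasSize K q → HasSize L (q ^ 3) →
    (emb : Embedding K L) → (u : Carrier L) → ¬ (∃[ a ] (ι emb a ≡ u)) →
    IsCuttingSystem K L emb 8 4 (U-example K L emb u)
proposition3p13 q q-prime-power K L |K|≡q |L|≡q³ emb u u∉K =
    (U-subspace , U-dimension , U-spans)
  , U-cutting (kernel-vector (prime-power>1 q-prime-power) |K|≡q |L|≡q³)
  where
  open Example emb (inj⇒≟ (↔⇒↣ (↔-sym |K|≡q))) u u∉K
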